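{- Let $\mathbb X$ be a basic set. Every partial function $f\in Min_{PR}(\mathbb X\to\mathbb N)\cup Max_{PR}(\mathbb X\to\mathbb N)$ has a graph $\{(x,y):f(x)\text{ is defined and }f(x)=y\}$ which is the intersection of a $\Sigma^0_1$ (r.e.) and a $\Pi^0_1$ (co-r.e.) subset of $\mathbb X\times\mathbb N$. The same holds for functionals: every functional in $Min_{PC}(\mathbb X\times P(\mathbb N)\to\mathbb N)\cup Max_{PC}(\mathbb X\times P(\mathbb N)\to\mathbb N)$ has graph which is the intersection of a $\Sigma^0_1$ and a $\Pi^0_1$ subset of $\mathbb X\times\mathbb N\times P(\mathbb N)$; and it relativizes: for every $A\subseteq\mathbb N$, every function in $Min^A_{PR}(\mathbb X\to\mathbb N)\cup Max^A_{PR}(\mathbb X\to\mathbb N)$ has graph which is the intersection of an $A$-r.e. set and the complement of an $A$-r.e. set.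
   Context: A basic set is a finite product of $\mathbb N$, $\mathbb Z$, $\Sigma^*$. For partial $\varphi:\mathbb X\times\mathbb N\to\mathbb N$, $(\min\varphi)(x)=\min\{\varphi(x,t):t\in\mathbb N,\varphi(x,t)\text{ defined}\}$ and $(\max\varphi)(x)$ is the max of that set, with $\min\emptyset,\max\emptyset$ and the max of an infinite set undefined. $Min_{PR}(\mathbb X\to\mathbb N)$ (resp. $Max_{PR}$) is the family of $\min\varphi$ (resp. $\max\varphi$) for partial recursive $\varphi$; $Min^A_{PR},Max^A_{PR}$ use partial $A$-recursive $\varphi$; $Min_{PC},Max_{PC}$ use partial computable functionals $\Phi:\mathbb X\times P(\mathbb N)\times\mathbb N\to\mathbb N$ (computed by oracle Turing machines) with $\min/\max$ over $t$. A subset of $\mathbb X\times\mathbb N\times P(\mathbb N)$ is $\Sigma^0_1$ if it is the domain of a partial computable functional, and $\Pi^0_1$ if its complement is $\Sigma^0_1$. -}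

module Defs where

open import Data.Nat using (ℕ; zero; suc; _+_; _*_; _≤_; _<_)
open import Data.Integer using (ℤ; +_; -[1+_])
open import Data.Fin using (Fin; toℕ)
open import Data.Vec using (Vec; []; _∷_; lookup; _++_)
open import Data.List using (List; []; _∷_; length)
open import Data.Bool using (Bool; true; false; if_then_else_)
open import Data.Product using (Σ; ∃; _×_; _,_)
open import Data.Unit using (⊤; tt)
open import Relation.Nullary using (¬_)
open import Function.Bundles using (_⇔_)

Oracle : Set
Oracle = ℕ → Bool

noOracle : Oracle
noOracle _ = false

-- Codes for (oracle) μ-recursive functions ℕ^n ⇀ ℕ.
-- Index o : Bool says whether the oracle instruction may be used
-- (o = false : partial recursive; o = true : partial oracle-computable).

data Code : Bool → ℕ → Set where
  zer  : ∀ {o n} → Code o n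
  succ : ∀ {o} → Code o 1
  proj : ∀ {o n} → Fin n → Code o n
  comp : ∀ {o m n} → Code o m → Vec (Code o n) m → Code o n
  prec : ∀ {o n} → Code o n → Code o (suc (suc n)) → Code o (suc n)
  mu   : ∀ {o n} → Code o (suc n) → Code o n
  orc  : Code true 1

mutual
  data Eval (A : Oracle) : ∀ {o n} → Code o n → Vec ℕ n → ℕ → Set where
    ev-zer  : ∀ {o n} {xs : Vec ℕ n} → Eval A (zer {o}) xs 0
    ev-succ : ∀ {o x} → Eval A (succ {o}) (x ∷ []) (suc x)
    ev-proj : ∀ {o n} {i : Fin n} {xs} → Eval A (proj {o} i) xs (lookup xs i)
    ev-comp : ∀ {o m n} {f : Code o m} {gs : Vec (Code o n) m} {xs ys y} →
              EvalAll A gs xs ys → Eval A f ys y → Eval A (comp f gs) xs y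
    ev-prec-z : ∀ {o n} {g : Code o n} {h} {xs y} →
              Eval A g xs y → Eval A (prec g h) (0 ∷ xs) y
    ev-prec-s : ∀ {o n} {g : Code o n} {h} {k xs r y} →
              Eval A (prec g h) (k ∷ xs) r → Eval A h (k ∷ r ∷ xs) y →
              Eval A (prec g h) (suc k ∷ xs) y
    ev-mu   : ∀ {o n} {f : Code o (suc n)} {xs y} →
              Eval A f (y ∷ xs) 0 →
              (∀ z → z < y → ∃ λ w → Eval A f (z ∷ xs) (suc w)) →
              Eval A (mu f) xs y
    ev-orc  : ∀ {x} → Eval A orc (x ∷ []) (if A x then 1 else 0)

  data EvalAll (A : Oracle) {o : Bool} {n : ℕ} :
         ∀ {m} → Vec (Code o n) m → Vec ℕ n → Vec ℕ m → Set where
    []  : ∀ {xs} → EvalAll A [] xs []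
    _∷_ : ∀ {m g y} {gs : Vec (Code o n) m} {xs ys} →
          Eval A g xs y → EvalAll A gs xs ys → EvalAll A (g ∷ gs) xs (y ∷ ys)

-- Basic sets: finite products of ℕ, ℤ and Σ* (Σ = Fin k, a fixed
-- finite alphabet), coded into ℕ by standard bijections.

data Sort : Set where
  nat int word : Sort

BasicSet : Set
BasicSet = List Sort

⟦_⟧S : ℕ → Sort → Set
⟦ k ⟧S nat  = ℕ
⟦ k ⟧S int  = ℤ
⟦ k ⟧S word = List (Fin k)

El : ℕ → BasicSet → Set
El k []       = ⊤
El k (s ∷ ss) = ⟦ k ⟧S s × El k ss

encInt : ℤ → ℕ
encInt (+ n)      = 2 * n
encInt -[1+ n ]   = suc (2 * n)

-- Σ* → ℕ : bijective base-k numeration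
encWord : ∀ {k} → List (Fin k) → ℕ
encWord             []       = 0
encWord {k} (a ∷ w) = suc (toℕ a + k * encWord w)

encSort : ∀ {k} s → ⟦ k ⟧S s → ℕ
encSort nat  n = n
encSort int  z = encInt z
encSort word w = encWord w

encode : ∀ {k} (X : BasicSet) → El k X → Vec ℕ (length X)
encode []       tt       = []
encode (s ∷ ss) (a , as) = encSort s a ∷ encode ss as

Φ : ∀ {o k} (A : Oracle) (X : BasicSet) → Code o (length X + 1) →
    El k X → ℕ → ℕ → Set
Φ A X c x t y = Eval A c (encode X x ++ (t ∷ [])) y

-- Graphs of min φ and max φ (min/max over t of the defined values).
-- max of an infinite set is undefined: this is automatic since all
-- values must be ≤ y.
MinGraph : ∀ {B : Set} → (B → ℕ → ℕ → Set) → B → ℕ → Set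
MinGraph φ x y = (∃ λ t → φ x t y) × (∀ t z → φ x t z → y ≤ z)

MaxGraph : ∀ {B : Set} → (B → ℕ → ℕ → Set) → B → ℕ → Set
MaxGraph φ x y = (∃ λ t → φ x t y) × (∀ t z → φ x t z → z ≤ y)

-- Classes Min/Max of partial functions X ⇀ ℕ given by graphs.
-- (o , A) = (false , noOracle) : Min_PR / Max_PR ;
-- (o , A) = (true , A)         : Min^A_PR / Max^A_PR.

InMin : ∀ k (o : Bool) (A : Oracle) (X : BasicSet) → (El k X → ℕ → Set) → Set
InMin k o A X f = Σ (Code o (length X + 1)) λ c →
  ∀ x y → f x y ⇔ MinGraph (Φ A X c) x y

InMax : ∀ k (o : Bool) (A : Oracle) (X : BasicSet) → (El k X → ℕ → Set) → Set
InMax k o A X f = Σ (Code o (length X + 1)) λ c →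
  ∀ x y → f x y ⇔ MaxGraph (Φ A X c) x y

IsΣ01 : ∀ k (o : Bool) (A : Oracle) (X : BasicSet) → (El k X → ℕ → Set) → Set
IsΣ01 k o A X S = Σ (Code o (length X + 1)) λ c →
  ∀ x y → S x y ⇔ (∃ λ z → Φ A X c x y z)

IsΠ01 : ∀ k (o : Bool) (A : Oracle) (X : BasicSet) → (El k X → ℕ → Set) → Set
IsΠ01 k o A X P = Σ (Code o (length X + 1)) λ c →
  ∀ x y → P x y ⇔ (¬ (∃ λ z → Φ A X c x y z))

SigmaPiGraph : ∀ k (o : Bool) (A : Oracle) (X : BasicSet) → (El k X → ℕ → Set) → Set₁
SigmaPiGraph k o A X f =
  Σ (El k X → ℕ → Set) λ S → Σ (El k X → ℕ → Set) λ P →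
    IsΣ01 k o A X S × IsΠ01 k o A X P × (∀ x y → f x y ⇔ (S x y × P x y))

InMinPC : ∀ k (X : BasicSet) → (El k X → Oracle → ℕ → Set) → Set
InMinPC k X F = Σ (Code true (length X + 1)) λ c →
  ∀ x A y → F x A y ⇔ MinGraph (Φ A X c) x y

InMaxPC : ∀ k (X : BasicSet) → (El k X → Oracle → ℕ → Set) → Set
InMaxPC k X F = Σ (Code true (length X + 1)) λ c →
  ∀ x A y → F x A y ⇔ MaxGraph (Φ A X c) x y

IsΣ01F : ∀ k (X : BasicSet) → (El k X → ℕ → Oracle → Set) → Set
IsΣ01F k X S = Σ (Code true (length X + 1)) λ c →
  ∀ x y A → S x y A ⇔ (∃ λ z → Φ A X c x y z)

IsΠ01F : ∀ k (X : BasicSet) → (El k X → ℕ → Oracle → Set) → Set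
IsΠ01F k X P = Σ (Code true (length X + 1)) λ c →
  ∀ x y A → P x y A ⇔ (¬ (∃ λ z → Φ A X c x y z))

SigmaPiGraphF : ∀ k (X : BasicSet) → (El k X → Oracle → ℕ → Set) → Set₁
SigmaPiGraphF k X F =
  Σ (El k X → ℕ → Oracle → Set) λ S → Σ (El k X → ℕ → Oracle → Set) λ P →
    IsΣ01F k X S × IsΠ01F k X P × (∀ x A y → F x A y ⇔ (S x y A × P x y A))

module Submission where

-- The graph of min φ is the set of pairs (x, y) such that φ(x, t) = y for some t,
-- minus the set of pairs such that φ(x, t) = z < y for some t and z (for max φ
-- read z > y).  Both sets are domains of computable functions, uniformly in the
-- oracle, by dovetailing: search for a clock p and an argument t < p such that the
-- p-clocked run of φ on (x, t) has a result z related to y.  This works because the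
-- clocked evaluation of a code, which answers "no result yet" instead of diverging,
-- is itself computed by a code, and it settles on φ(x, t) once the clock is large.

open import Defs
open import Data.Nat using (ℕ; zero; suc; _+_; _∸_; _≤_; _<_; _⊔_; _≟_; pred)
open import Data.Nat.Properties
open import Data.Nat.Induction using (<-rec)
open import Data.Bool using (Bool; true; false; if_then_else_)
open import Data.Fin using (Fin; zero; suc; _↑ˡ_; _↑ʳ_)
open import Data.List using (length)
open import Data.Vec using (Vec; []; _∷_; lookup; _++_; map; tabulate)
open import Data.Vec.Properties using (lookup-++ˡ; lookup-++ʳ; tabulate∘lookup; tabulate-cong; map-∘; map-id)
open import Data.Product using (∃; _×_; _,_; proj₂)
open import Data.Product.Function.NonDependent.Propositional using (_×-⇔_)
open import Data.Sum using (_⊎_; inj₁; inj₂)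
open import Function using (_∘_)
open import Function.Bundles using (_⇔_; mk⇔; Equivalence)
open import Function.Properties.Equivalence using () renaming (refl to ⇔-refl; sym to ⇔-sym; trans to ⇔-trans)
open import Relation.Nullary using (¬_; yes; no; contradiction)
open import Relation.Binary.PropositionalEquality

open Equivalence using (to; from)

Halts : ∀ {o n} → Oracle → Code o n → Vec ℕ n → Set
Halts A c xs = ∃ (Eval A c xs)

mutual
  eval-deterministic : ∀ {A o n} {c : Code o n} {xs y y′} →
                       Eval A c xs y → Eval A c xs y′ → y ≡ y′
  eval-deterministic ev-zer  ev-zer  = refl
  eval-deterministic ev-succ ev-succ = refl
  eval-deterministic ev-proj ev-proj = refl
  eval-deterministic ev-orc  ev-orc  = refl
  eval-deterministic (ev-comp es e) (ev-comp es′ e′)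
    with evalAll-deterministic es es′
  ... | refl = eval-deterministic e e′
  eval-deterministic (ev-prec-z e) (ev-prec-z e′) = eval-deterministic e e′
  eval-deterministic (ev-prec-s e h) (ev-prec-s e′ h′)
    with eval-deterministic e e′
  ... | refl = eval-deterministic h h′
  eval-deterministic (ev-mu e₀ pos) (ev-mu e₀′ pos′) = ≤-antisym
    (≮⇒≥ λ y′<y → 0≢1+n (eval-deterministic e₀′ (proj₂ (pos _ y′<y))))
    (≮⇒≥ λ y<y′ → 0≢1+n (eval-deterministic e₀ (proj₂ (pos′ _ y<y′))))

  evalAll-deterministic : ∀ {A o n m} {gs : Vec (Code o n) m} {xs ys ys′} →
                          EvalAll A gs xs ys → EvalAll A gs xs ys′ → ys ≡ ys′
  evalAll-deterministic []       []         = refl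
  evalAll-deterministic (e ∷ es) (e′ ∷ es′) =
    cong₂ _∷_ (eval-deterministic e e′) (evalAll-deterministic es es′)

LeastZero : (ℕ → ℕ) → Set
LeastZero g = ∃ λ z → g z ≡ 0 × (∀ w → w < z → g w ≢ 0)

leastZero : (g : ℕ → ℕ) → ∀ p → g p ≡ 0 → LeastZero g
leastZero g = <-rec (λ p → g p ≡ 0 → LeastZero g) search
  where
  search : ∀ p → (∀ {w} → w < p → g w ≡ 0 → LeastZero g) → g p ≡ 0 → LeastZero g
  search p smaller gp≡0 with anyUpTo? (λ w → g w ≟ 0) p
  ... | yes (w , w<p , gw≡0) = smaller w<p gw≡0
  ... | no noneBelow         = p , gp≡0 , λ w w<p gw≡0 → noneBelow (w , w<p , gw≡0)

mu-halts⇔ : ∀ {A o n} {f : Code o (suc n)} {xs} (g : ℕ → ℕ) →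
            (∀ p → Eval A f (p ∷ xs) (g p)) → Halts A (mu f) xs ⇔ (∃ λ p → g p ≡ 0)
mu-halts⇔ {A} {f = f} {xs} g eval-f = mk⇔
  (λ { (z , ev-mu e₀ _) → z , sym (eval-deterministic e₀ (eval-f z)) })
  (λ (p , gp≡0) → let (z , gz≡0 , below) = leastZero g p gp≡0 in
     z , ev-mu (subst (Eval A f _) gz≡0 (eval-f z)) (λ w w<z → positive w (below w w<z)))
  where
  positive : ∀ w → g w ≢ 0 → ∃ λ k → Eval A f (w ∷ xs) (suc k)
  positive w gw≢0 with g w | eval-f w
  ... | zero  | _ = contradiction refl gw≢0
  ... | suc k | e = k , e

ifZero : ℕ → ℕ → ℕ → ℕ
ifZero zero    b c = b
ifZero (suc _) b c = c

allNonZero : ∀ {m} → Vec ℕ m → ℕ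
allNonZero []       = 1
allNonZero (v ∷ vs) = ifZero v 0 (allNonZero vs)

allNonZero-map-suc : ∀ {m} (ys : Vec ℕ m) → allNonZero (map suc ys) ≡ 1
allNonZero-map-suc []       = refl
allNonZero-map-suc (y ∷ ys) = allNonZero-map-suc ys

map-pred-suc : ∀ {m} (ys : Vec ℕ m) → map pred (map suc ys) ≡ ys
map-pred-suc ys = trans (sym (map-∘ pred suc ys)) (map-id ys)

-- In a clocked value, 0 means "no result yet" and suc y means "result y".

clockedRec : ∀ {n} → (Vec ℕ n → ℕ) → (Vec ℕ (suc (suc n)) → ℕ) → Vec ℕ n → ℕ → ℕ
clockedRec G H xs zero    = G xs
clockedRec G H xs (suc k) = ifZero r 0 (H (k ∷ pred r ∷ xs))
  where r = clockedRec G H xs k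

-- The state of the search for the least zero of the clocked values F z:
-- 0 while every F z seen so far is a nonzero result, 1 once some F z has
-- no result, and 2 + z once F z is the result 0.
muStep : ℕ → ℕ → ℕ
muStep v z = ifZero v 1 (ifZero (pred v) (suc (suc z)) 0)

muScan : (ℕ → ℕ) → ℕ → ℕ
muScan F zero    = 0
muScan F (suc k) = ifZero (muScan F k) (muStep (F k) k) (muScan F k)

NonZeroResultsBelow : (ℕ → ℕ) → ℕ → Set
NonZeroResultsBelow F y = ∀ z → z < y → ∃ λ w → F z ≡ suc (suc w)

muScan≡0⇒ : ∀ F k → muScan F k ≡ 0 → NonZeroResultsBelow F k
muScan≡0⇒ F (suc k) scan≡0 z z<1+k with muScan F k in scan | F k in Fk
muScan≡0⇒ F (suc k) () z z<1+k | suc _ | _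
muScan≡0⇒ F (suc k) () z z<1+k | zero  | zero
muScan≡0⇒ F (suc k) () z z<1+k | zero  | suc zero
... | zero | suc (suc w) with m<1+n⇒m<n∨m≡n z<1+k
...   | inj₁ z<k  = muScan≡0⇒ F k scan z z<k
...   | inj₂ refl = w , Fk

muScan≡2+⇒ : ∀ F k y → muScan F k ≡ suc (suc y) → F y ≡ 1 × NonZeroResultsBelow F y
muScan≡2+⇒ F (suc k) y found with muScan F k in scan
... | suc _ = muScan≡2+⇒ F k y (trans scan found)
... | zero with F k in Fk
muScan≡2+⇒ F (suc k) y ()    | zero | zero
muScan≡2+⇒ F (suc k) y refl  | zero | suc zero     = Fk , muScan≡0⇒ F k scan
muScan≡2+⇒ F (suc k) y ()    | zero | suc (suc _)

muScan-searching : ∀ F y → NonZeroResultsBelow F y → ∀ k → k ≤ y → muScan F k ≡ 0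
muScan-searching F y pos zero    _     = refl
muScan-searching F y pos (suc k) k<y
  rewrite muScan-searching F y pos k (<⇒≤ k<y) | proj₂ (pos k k<y) = refl

muScan-found : ∀ F y → F y ≡ 1 → NonZeroResultsBelow F y → ∀ k → y < k → muScan F k ≡ suc (suc y)
muScan-found F y Fy≡1 pos (suc k) y<1+k with m<1+n⇒m<n∨m≡n y<1+k
... | inj₁ y<k  rewrite muScan-found F y Fy≡1 pos k y<k = refl
... | inj₂ refl rewrite muScan-searching F y pos y ≤-refl | Fy≡1 = refl

-- clocked A c s xs evaluates c on xs, searching below s in every μ.
mutual
  clocked : ∀ {o n} → Oracle → Code o n → ℕ → Vec ℕ n → ℕ
  clocked A zer         s xs       = 1
  clocked A succ        s (x ∷ []) = suc (suc x)
  clocked A (proj i)    s xs       = suc (lookup xs i)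
  clocked A orc         s (x ∷ []) = suc (if A x then 1 else 0)
  clocked A (comp f gs) s xs       =
    ifZero (allNonZero (clockedAll A gs s xs)) 0 (clocked A f s (map pred (clockedAll A gs s xs)))
  clocked A (prec g h)  s (k ∷ xs) = clockedRec (clocked A g s) (clocked A h s) xs k
  clocked A (mu f)      s xs       = pred (muScan (λ z → clocked A f s (z ∷ xs)) s)

  clockedAll : ∀ {o n m} → Oracle → Vec (Code o n) m → ℕ → Vec ℕ n → Vec ℕ m
  clockedAll A []       s xs = []
  clockedAll A (g ∷ gs) s xs = clocked A g s xs ∷ clockedAll A gs s xs

mutual
  clocked-sound : ∀ {o n} A (c : Code o n) s xs {y} → clocked A c s xs ≡ suc y → Eval A c xs y
  clocked-sound A zer      s xs       refl = ev-zer
  clocked-sound A succ     s (x ∷ []) refl = ev-succ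
  clocked-sound A (proj i) s xs       refl = ev-proj
  clocked-sound A orc      s (x ∷ []) refl = ev-orc
  clocked-sound A (comp f gs) s xs eq with allNonZero (clockedAll A gs s xs) in allPos
  ... | suc _ = ev-comp (clockedAll-sound A gs s xs allPos) (clocked-sound A f s _ eq)
  clocked-sound A (prec g h) s (k ∷ xs) eq =
    clockedRec-sound A (clocked-sound A g s) (clocked-sound A h s) xs k eq
  clocked-sound A (mu f) s xs eq with muScan (λ z → clocked A f s (z ∷ xs)) s in scan
  clocked-sound A (mu f) s xs refl | suc (suc y)
    with muScan≡2+⇒ (λ z → clocked A f s (z ∷ xs)) s y scan
  ... | F≡1 , pos = ev-mu (clocked-sound A f s _ F≡1)
          (λ z z<y → let (w , Fz) = pos z z<y in w , clocked-sound A f s _ Fz)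

  clockedAll-sound : ∀ {o n m} A (gs : Vec (Code o n) m) s xs {a} →
                     allNonZero (clockedAll A gs s xs) ≡ suc a →
                     EvalAll A gs xs (map pred (clockedAll A gs s xs))
  clockedAll-sound A []       s xs allPos = []
  clockedAll-sound A (g ∷ gs) s xs allPos with clocked A g s xs in eq
  ... | suc _ = clocked-sound A g s xs eq ∷ clockedAll-sound A gs s xs allPos

  clockedRec-sound : ∀ {o n} A {g : Code o n} {h} {G H} →
    (∀ xs {y} → G xs ≡ suc y → Eval A g xs y) → (∀ xs {y} → H xs ≡ suc y → Eval A h xs y) →
    ∀ xs k {y} → clockedRec G H xs k ≡ suc y → Eval A (prec g h) (k ∷ xs) y
  clockedRec-sound A sound-g sound-h xs zero    eq = ev-prec-z (sound-g xs eq)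
  clockedRec-sound A {G = G} {H} sound-g sound-h xs (suc k) eq with clockedRec G H xs k in r
  ... | suc _ = ev-prec-s (clockedRec-sound A sound-g sound-h xs k r) (sound-h _ eq)

Eventually : (ℕ → Set) → Set
Eventually P = ∃ λ s₀ → ∀ {s} → s₀ ≤ s → P s

eventually-≥ : ∀ n → Eventually (n ≤_)
eventually-≥ n = n , λ n≤s → n≤s

eventually-map : ∀ {P Q : ℕ → Set} → (∀ {s} → P s → Q s) → Eventually P → Eventually Q
eventually-map f (s₀ , p) = s₀ , f ∘ p

eventually-zip : ∀ {P Q R : ℕ → Set} → (∀ {s} → P s → Q s → R s) →
                 Eventually P → Eventually Q → Eventually R
eventually-zip f (a , p) (b , q) =
  a ⊔ b , λ le → f (p (≤-trans (m≤m⊔n a b) le)) (q (≤-trans (m≤n⊔m a b) le))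

eventually-∀< : ∀ {P : ℕ → ℕ → Set} y → (∀ z → z < y → Eventually (P z)) →
                Eventually (λ s → ∀ z → z < y → P z s)
eventually-∀< zero    _  = 0 , λ _ _ ()
eventually-∀< {P} (suc y) ev =
  eventually-zip extend (eventually-∀< y (λ z z<y → ev z (m<n⇒m<1+n z<y))) (ev y ≤-refl)
  where
  extend : ∀ {s} → (∀ z → z < y → P z s) → P y s → ∀ z → z < suc y → P z s
  extend below at z z<1+y with m<1+n⇒m<n∨m≡n z<1+y
  ... | inj₁ z<y  = below z z<y
  ... | inj₂ refl = at

eventually⇒∃ : ∀ {P : ℕ → Set} → Eventually P → ∃ P
eventually⇒∃ (s₀ , p) = s₀ , p ≤-refl

mutual
  clocked-complete : ∀ {A o n} {c : Code o n} {xs y} → Eval A c xs y →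
                     Eventually (λ s → clocked A c s xs ≡ suc y)
  clocked-complete ev-zer  = 0 , λ _ → refl
  clocked-complete ev-succ = 0 , λ _ → refl
  clocked-complete ev-proj = 0 , λ _ → refl
  clocked-complete ev-orc  = 0 , λ _ → refl
  clocked-complete {A} {c = comp f gs} {xs} (ev-comp {ys = ys} es e) =
    eventually-zip step (clockedAll-complete es) (clocked-complete e)
    where
    step : ∀ {s y} → clockedAll A gs s xs ≡ map suc ys → clocked A f s ys ≡ suc y →
           clocked A (comp f gs) s xs ≡ suc y
    step gs≡ f≡ rewrite gs≡ | allNonZero-map-suc ys | map-pred-suc ys = f≡
  clocked-complete (ev-prec-z e) = clocked-complete e
  clocked-complete {A} {c = prec g h} {suc k ∷ xs} (ev-prec-s e e′) =
    eventually-zip step (clocked-complete e) (clocked-complete e′)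
    where
    step : ∀ {s r y} → clocked A (prec g h) s (k ∷ xs) ≡ suc r →
           clocked A h s (k ∷ r ∷ xs) ≡ suc y →
           clocked A (prec g h) s (suc k ∷ xs) ≡ suc y
    step r≡ h≡ rewrite r≡ = h≡
  clocked-complete {A} {c = mu f} {xs} {y} (ev-mu e₀ pos) =
    eventually-zip step (eventually-≥ (suc y))
      (eventually-zip _,_ (clocked-complete e₀)
        (eventually-∀< y λ z z<y → let (w , e) = pos z z<y in
          eventually-map (w ,_) (clocked-complete e)))
    where
    step : ∀ {s} → y < s →
           clocked A f s (y ∷ xs) ≡ 1 × NonZeroResultsBelow (λ z → clocked A f s (z ∷ xs)) y →
           clocked A (mu f) s xs ≡ suc y
    step {s} y<s (Fy≡1 , posBelow)
      rewrite muScan-found (λ z → clocked A f s (z ∷ xs)) y Fy≡1 posBelow s y<s = refl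

  clockedAll-complete : ∀ {A o n m} {gs : Vec (Code o n) m} {xs ys} → EvalAll A gs xs ys →
                        Eventually (λ s → clockedAll A gs s xs ≡ map suc ys)
  clockedAll-complete []       = 0 , λ _ → refl
  clockedAll-complete (e ∷ es) =
    eventually-zip (cong₂ _∷_) (clocked-complete e) (clockedAll-complete es)

eval-prec : ∀ {A o n} {g : Code o n} {h xs} (F : ℕ → ℕ) → Eval A g xs (F 0) →
            (∀ k → Eval A h (k ∷ F k ∷ xs) (F (suc k))) → ∀ k → Eval A (prec g h) (k ∷ xs) (F k)
eval-prec F eval-g eval-h zero    = ev-prec-z eval-g
eval-prec F eval-g eval-h (suc k) = ev-prec-s (eval-prec F eval-g eval-h k) (eval-h k)

module _ {o : Bool} where

  predCode : Code o 1
  predCode = prec zer (proj zero)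

  ifZeroCode : Code o 3
  ifZeroCode = prec (proj zero) (proj (suc (suc (suc zero))))

  monusCode : Code o 2
  monusCode = comp (prec (proj zero) (comp predCode (proj (suc zero) ∷ [])))
                   (proj (suc zero) ∷ proj zero ∷ [])

module _ {A : Oracle} {o : Bool} where

  eval-predCode : ∀ u → Eval A (predCode {o}) (u ∷ []) (pred u)
  eval-predCode = eval-prec pred ev-zer (λ _ → ev-proj)

  eval-ifZeroCode : ∀ u v w → Eval A (ifZeroCode {o}) (u ∷ v ∷ w ∷ []) (ifZero u v w)
  eval-ifZeroCode u v w = eval-prec (λ u → ifZero u v w) ev-proj (λ _ → ev-proj) u

  eval-monusCode : ∀ u v → Eval A (monusCode {o}) (u ∷ v ∷ []) (u ∸ v)
  eval-monusCode u v = ev-comp (ev-proj ∷ ev-proj ∷ []) (eval-prec (u ∸_) ev-proj eval-step v)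
    where
    eval-step : ∀ k → Eval A (comp predCode (proj (suc zero) ∷ [])) (k ∷ u ∸ k ∷ u ∷ []) (u ∸ suc k)
    eval-step k = subst (Eval A _ _) (pred[m∸n]≡m∸[1+n] u k) (ev-comp (ev-proj ∷ []) (eval-predCode _))

module _ {o : Bool} {n : ℕ} where

  oneᶜ : Code o n
  oneᶜ = comp succ (zer ∷ [])

  succᶜ : Code o n → Code o n
  succᶜ a = comp succ (a ∷ [])

  predᶜ : Code o n → Code o n
  predᶜ a = comp predCode (a ∷ [])

  ifZeroᶜ : Code o n → Code o n → Code o n → Code o n
  ifZeroᶜ a b c = comp ifZeroCode (a ∷ b ∷ c ∷ [])

  _∸ᶜ_ : Code o n → Code o n → Code o n
  a ∸ᶜ b = comp monusCode (a ∷ b ∷ [])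

  muStepᶜ : Code o n → Code o n → Code o n
  muStepᶜ v z = ifZeroᶜ v oneᶜ (ifZeroᶜ (predᶜ v) (succᶜ (succᶜ z)) zer)

  allNonZeroᶜ : ∀ {m} → Vec (Code o n) m → Code o n
  allNonZeroᶜ []       = oneᶜ
  allNonZeroᶜ (c ∷ cs) = ifZeroᶜ c zer (allNonZeroᶜ cs)

module _ {A : Oracle} {o : Bool} {n : ℕ} {xs : Vec ℕ n} where

  eval-oneᶜ : Eval A (oneᶜ {o}) xs 1
  eval-oneᶜ = ev-comp (ev-zer ∷ []) ev-succ

  eval-succᶜ : ∀ {a u} → Eval A {o} a xs u → Eval A (succᶜ a) xs (suc u)
  eval-succᶜ ea = ev-comp (ea ∷ []) ev-succ

  eval-predᶜ : ∀ {a u} → Eval A {o} a xs u → Eval A (predᶜ a) xs (pred u)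
  eval-predᶜ ea = ev-comp (ea ∷ []) (eval-predCode _)

  eval-ifZeroᶜ : ∀ {a b c u v w} → Eval A {o} a xs u → Eval A b xs v → Eval A c xs w →
                 Eval A (ifZeroᶜ a b c) xs (ifZero u v w)
  eval-ifZeroᶜ ea eb ec = ev-comp (ea ∷ eb ∷ ec ∷ []) (eval-ifZeroCode _ _ _)

  eval-∸ᶜ : ∀ {a b u v} → Eval A {o} a xs u → Eval A b xs v → Eval A (a ∸ᶜ b) xs (u ∸ v)
  eval-∸ᶜ ea eb = ev-comp (ea ∷ eb ∷ []) (eval-monusCode _ _)

  eval-muStepᶜ : ∀ {v z a b} → Eval A {o} v xs a → Eval A z xs b → Eval A (muStepᶜ v z) xs (muStep a b)
  eval-muStepᶜ ev ez =
    eval-ifZeroᶜ ev eval-oneᶜ (eval-ifZeroᶜ (eval-predᶜ ev) (eval-succᶜ (eval-succᶜ ez)) ev-zer)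

  eval-allNonZeroᶜ : ∀ {m} {cs : Vec (Code o n) m} {vs} → EvalAll A cs xs vs →
                     Eval A (allNonZeroᶜ cs) xs (allNonZero vs)
  eval-allNonZeroᶜ []       = eval-oneᶜ
  eval-allNonZeroᶜ (e ∷ es) = eval-ifZeroᶜ e ev-zer (eval-allNonZeroᶜ es)

  eval-map-predᶜ : ∀ {m} {cs : Vec (Code o n) m} {vs} → EvalAll A cs xs vs →
                   EvalAll A (map predᶜ cs) xs (map pred vs)
  eval-map-predᶜ []       = []
  eval-map-predᶜ (e ∷ es) = eval-predᶜ e ∷ eval-map-predᶜ es

projᶜs : ∀ {o n m} → (Fin m → Fin n) → Vec (Code o n) m
projᶜs σ = tabulate (proj ∘ σ)

eval-projᶜs : ∀ {A o n m} (σ : Fin m → Fin n) zs →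
              EvalAll A (projᶜs {o} σ) zs (tabulate (lookup zs ∘ σ))
eval-projᶜs {m = zero}  σ zs = []
eval-projᶜs {m = suc m} σ zs = ev-proj ∷ eval-projᶜs (σ ∘ suc) zs

dropᶜ : ∀ {o n} k → Vec (Code o (k + n)) n
dropᶜ k = projᶜs (k ↑ʳ_)

eval-dropᶜ : ∀ {A o n} k (ys : Vec ℕ k) (xs : Vec ℕ n) → EvalAll A (dropᶜ {o} k) (ys ++ xs) xs
eval-dropᶜ k ys xs = subst (EvalAll _ _ _)
  (trans (tabulate-cong (lookup-++ʳ ys xs)) (tabulate∘lookup xs)) (eval-projᶜs (k ↑ʳ_) (ys ++ xs))

evalAll-++ : ∀ {A o n m k} {gs : Vec (Code o n) m} {hs : Vec (Code o n) k} {xs us vs} →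
             EvalAll A gs xs us → EvalAll A hs xs vs → EvalAll A (gs ++ hs) xs (us ++ vs)
evalAll-++ []       ehs = ehs
evalAll-++ (e ∷ es) ehs = e ∷ evalAll-++ es ehs

module _ {o : Bool} {n : ℕ} where

  recStepᶜ : Code o (suc (suc (suc n))) → Code o (suc (suc (suc n)))
  recStepᶜ H = ifZeroᶜ (proj (suc zero)) zer
    (comp H (proj (suc (suc zero)) ∷ proj zero ∷ predᶜ (proj (suc zero)) ∷ dropᶜ 3))

  scanStepᶜ : Code o (suc (suc n)) → Code o (suc (suc (suc n)))
  scanStepᶜ F = ifZeroᶜ (proj (suc zero))
    (muStepᶜ (comp F (proj (suc (suc zero)) ∷ proj zero ∷ dropᶜ 3)) (proj zero)) (proj (suc zero))

module _ {A : Oracle} {o : Bool} {n : ℕ} (s : ℕ) where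

  eval-recStepᶜ : ∀ {H : Code o (suc (suc (suc n)))} {Hv : Vec ℕ (suc (suc n)) → ℕ} →
                  (∀ ys → Eval A H (s ∷ ys) (Hv ys)) →
                  ∀ j r xs → Eval A (recStepᶜ H) (j ∷ r ∷ s ∷ xs) (ifZero r 0 (Hv (j ∷ pred r ∷ xs)))
  eval-recStepᶜ eval-H j r xs = eval-ifZeroᶜ ev-proj ev-zer
    (ev-comp (ev-proj ∷ ev-proj ∷ eval-predᶜ ev-proj ∷ eval-dropᶜ 3 (j ∷ r ∷ s ∷ []) xs) (eval-H _))

  eval-scanStepᶜ : ∀ {F : Code o (suc (suc n))} {Fv : Vec ℕ (suc n) → ℕ} →
                   (∀ ys → Eval A F (s ∷ ys) (Fv ys)) →
                   ∀ k r xs → Eval A (scanStepᶜ F) (k ∷ r ∷ s ∷ xs) (ifZero r (muStep (Fv (k ∷ xs)) k) r)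
  eval-scanStepᶜ eval-F k r xs = eval-ifZeroᶜ ev-proj
    (eval-muStepᶜ (ev-comp (ev-proj ∷ ev-proj ∷ eval-dropᶜ 3 (k ∷ r ∷ s ∷ []) xs) (eval-F (k ∷ xs)))
                  ev-proj)
    ev-proj

mutual
  clockedCode : ∀ {o n} → Code o n → Code o (suc n)
  clockedCode zer         = oneᶜ
  clockedCode succ        = succᶜ (succᶜ (proj (suc zero)))
  clockedCode (proj i)    = succᶜ (proj (suc i))
  clockedCode orc         = succᶜ (comp orc (proj (suc zero) ∷ []))
  clockedCode (comp f gs) = ifZeroᶜ (allNonZeroᶜ (clockedCodes gs)) zer
    (comp (clockedCode f) (proj zero ∷ map predᶜ (clockedCodes gs)))
  clockedCode (prec g h)  =
    comp (prec (clockedCode g) (recStepᶜ (clockedCode h))) (proj (suc zero) ∷ proj zero ∷ dropᶜ 2)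
  clockedCode (mu f)      =
    predᶜ (comp (prec zer (scanStepᶜ (clockedCode f))) (proj zero ∷ proj zero ∷ dropᶜ 1))

  clockedCodes : ∀ {o n m} → Vec (Code o n) m → Vec (Code o (suc n)) m
  clockedCodes []       = []
  clockedCodes (g ∷ gs) = clockedCode g ∷ clockedCodes gs

mutual
  eval-clockedCode : ∀ {o n} A (c : Code o n) s xs → Eval A (clockedCode c) (s ∷ xs) (clocked A c s xs)
  eval-clockedCode A zer      s xs       = eval-oneᶜ
  eval-clockedCode A succ     s (x ∷ []) = eval-succᶜ (eval-succᶜ ev-proj)
  eval-clockedCode A (proj i) s xs       = eval-succᶜ ev-proj
  eval-clockedCode A orc      s (x ∷ []) = eval-succᶜ (ev-comp (ev-proj ∷ []) ev-orc)
  eval-clockedCode A (comp f gs) s xs    = eval-ifZeroᶜ (eval-allNonZeroᶜ eval-gs) ev-zer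
    (ev-comp (ev-proj ∷ eval-map-predᶜ eval-gs) (eval-clockedCode A f s _))
    where
    eval-gs : EvalAll A (clockedCodes gs) (s ∷ xs) (clockedAll A gs s xs)
    eval-gs = eval-clockedCodes A gs s xs
  eval-clockedCode A (prec g h) s (k ∷ xs) =
    ev-comp (ev-proj ∷ ev-proj ∷ eval-dropᶜ 2 (s ∷ k ∷ []) xs)
      (eval-prec (clockedRec (clocked A g s) (clocked A h s) xs) (eval-clockedCode A g s xs)
        (λ j → eval-recStepᶜ s (eval-clockedCode A h s) j _ xs) k)
  eval-clockedCode A (mu f) s xs =
    eval-predᶜ (ev-comp (ev-proj ∷ ev-proj ∷ eval-dropᶜ 1 (s ∷ []) xs)
      (eval-prec (muScan (λ z → clocked A f s (z ∷ xs))) ev-zer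
        (λ k → eval-scanStepᶜ s (eval-clockedCode A f s) k _ xs) s))

  eval-clockedCodes : ∀ {o n m} A (gs : Vec (Code o n) m) s xs →
                      EvalAll A (clockedCodes gs) (s ∷ xs) (clockedAll A gs s xs)
  eval-clockedCodes A []       s xs = []
  eval-clockedCodes A (g ∷ gs) s xs = eval-clockedCode A g s xs ∷ eval-clockedCodes A gs s xs

anyZeroBelow : (ℕ → ℕ) → ℕ → ℕ
anyZeroBelow d zero    = 1
anyZeroBelow d (suc t) = ifZero (anyZeroBelow d t) 0 (d t)

anyZeroBelow≡0⇒ : ∀ d K → anyZeroBelow d K ≡ 0 → ∃ λ t → t < K × d t ≡ 0
anyZeroBelow≡0⇒ d (suc K) eq with anyZeroBelow d K in below
... | zero  = let (t , t<K , dt≡0) = anyZeroBelow≡0⇒ d K below in t , m<n⇒m<1+n t<K , dt≡0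
... | suc _ = K , ≤-refl , eq

anyZeroBelow≡0⇐ : ∀ d K t → t < K → d t ≡ 0 → anyZeroBelow d K ≡ 0
anyZeroBelow≡0⇐ d (suc K) t t<1+K dt≡0 with anyZeroBelow d K in below | m<1+n⇒m<n∨m≡n t<1+K
... | zero  | _         = refl
... | suc _ | inj₁ t<K  = contradiction (trans (sym below) (anyZeroBelow≡0⇐ d K t t<K dt≡0)) 1+n≢0
... | suc _ | inj₂ refl = dt≡0

boundedZeroᶜ : ∀ {o n} → Code o (suc n) → Code o (suc n)
boundedZeroᶜ D = prec oneᶜ (ifZeroᶜ (proj (suc zero)) zer (comp D (proj zero ∷ dropᶜ 2)))

eval-boundedZeroᶜ : ∀ {A o n} {D : Code o (suc n)} {d : ℕ → ℕ} {zs} →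
                    (∀ t → Eval A D (t ∷ zs) (d t)) →
                    ∀ K → Eval A (boundedZeroᶜ D) (K ∷ zs) (anyZeroBelow d K)
eval-boundedZeroᶜ {zs = zs} eval-D = eval-prec _ eval-oneᶜ λ t →
  eval-ifZeroᶜ ev-proj ev-zer (ev-comp (ev-proj ∷ eval-dropᶜ 2 (t ∷ _ ∷ []) zs) (eval-D t))

module Search {o N} (c : Code o (N + 1)) {r : ℕ → ℕ → ℕ} (R : Code o 2)
              (eval-R : ∀ {A} z y → Eval A R (z ∷ y ∷ []) (r z y)) where

  resultTest : ℕ → ℕ → ℕ
  resultTest v y = ifZero v 1 (r (pred v) y)

  resultTest≡0⇒ : ∀ v y → resultTest v y ≡ 0 → ∃ λ z → v ≡ suc z × r z y ≡ 0
  resultTest≡0⇒ (suc z) y rzy≡0 = z , refl , rzy≡0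

  clockedRunᶜ : Code o (suc (suc (N + 1)))
  clockedRunᶜ = comp (clockedCode c)
    (proj (suc zero) ∷ projᶜs (λ i → suc (suc (i ↑ˡ 1))) ++ proj zero ∷ [])

  testᶜ : Code o (suc (suc (N + 1)))
  testᶜ = ifZeroᶜ clockedRunᶜ oneᶜ (comp R (predᶜ clockedRunᶜ ∷ proj (suc (suc (N ↑ʳ zero))) ∷ []))

  queryᶜ : Code o (suc (N + 1))
  queryᶜ = comp (boundedZeroᶜ testᶜ) (proj zero ∷ proj zero ∷ dropᶜ 1)

  searchCode : Code o (N + 1)
  searchCode = mu queryᶜ

  module _ (A : Oracle) (xs : Vec ℕ N) (y : ℕ) where

    hit : ℕ → ℕ → ℕ
    hit p t = resultTest (clocked A c p (xs ++ t ∷ [])) y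

    eval-clockedRunᶜ : ∀ t p → Eval A clockedRunᶜ (t ∷ p ∷ xs ++ y ∷ []) (clocked A c p (xs ++ t ∷ []))
    eval-clockedRunᶜ t p = ev-comp (ev-proj ∷ evalAll-++ eval-xs (ev-proj ∷ [])) (eval-clockedCode A c p _)
      where
      eval-xs : EvalAll A (projᶜs (λ i → suc (suc (i ↑ˡ 1)))) (t ∷ p ∷ xs ++ y ∷ []) xs
      eval-xs = subst (EvalAll A _ _)
        (trans (tabulate-cong (lookup-++ˡ xs (y ∷ []))) (tabulate∘lookup xs)) (eval-projᶜs _ _)

    eval-testᶜ : ∀ t p → Eval A testᶜ (t ∷ p ∷ xs ++ y ∷ []) (hit p t)
    eval-testᶜ t p = eval-ifZeroᶜ (eval-clockedRunᶜ t p) eval-oneᶜ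
      (ev-comp (eval-predᶜ (eval-clockedRunᶜ t p) ∷ eval-y ∷ []) (eval-R _ _))
      where
      eval-y : Eval A (proj (suc (suc (N ↑ʳ zero)))) (t ∷ p ∷ xs ++ y ∷ []) y
      eval-y = subst (Eval A _ _) (lookup-++ʳ xs (y ∷ []) zero) ev-proj

    eval-queryᶜ : ∀ p → Eval A queryᶜ (p ∷ xs ++ y ∷ []) (anyZeroBelow (hit p) p)
    eval-queryᶜ p = ev-comp (ev-proj ∷ ev-proj ∷ eval-dropᶜ 1 (p ∷ []) _)
      (eval-boundedZeroᶜ (λ t → eval-testᶜ t p) p)

    searchCode-halts⇔ : Halts A searchCode (xs ++ y ∷ []) ⇔
                        (∃ λ t → ∃ λ z → Eval A c (xs ++ t ∷ []) z × r z y ≡ 0)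
    searchCode-halts⇔ = ⇔-trans (mu-halts⇔ _ eval-queryᶜ) (mk⇔ found search)
      where
      found : (∃ λ p → anyZeroBelow (hit p) p ≡ 0) →
              ∃ λ t → ∃ λ z → Eval A c (xs ++ t ∷ []) z × r z y ≡ 0
      found (p , query≡0) =
        let (t , _ , hit≡0)    = anyZeroBelow≡0⇒ (hit p) p query≡0
            (z , run≡ , rzy≡0) = resultTest≡0⇒ _ y hit≡0
        in t , z , clocked-sound A c p _ run≡ , rzy≡0

      search : (∃ λ t → ∃ λ z → Eval A c (xs ++ t ∷ []) z × r z y ≡ 0) →
               ∃ λ p → anyZeroBelow (hit p) p ≡ 0
      search (t , z , e , rzy≡0) =
        let (p , t<p , run≡) = eventually⇒∃ (eventually-zip _,_ (eventually-≥ (suc t)) (clocked-complete e))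
        in p , anyZeroBelow≡0⇐ (hit p) p t t<p (subst (λ v → resultTest v y ≡ 0) (sym run≡) rzy≡0)

apart : ℕ → ℕ → ℕ
apart z y = ifZero (z ∸ y) (y ∸ z) 1

apart≡0⇒≡ : ∀ z y → apart z y ≡ 0 → z ≡ y
apart≡0⇒≡ z y y∸z≡0 with z ∸ y in z∸y≡0
... | zero = ≤-antisym (m∸n≡0⇒m≤n z∸y≡0) (m∸n≡0⇒m≤n y∸z≡0)

apart-refl : ∀ y → apart y y ≡ 0
apart-refl y rewrite n∸n≡0 y = refl

module _ {o : Bool} where

  apartCode : Code o 2
  apartCode = ifZeroᶜ (proj zero ∸ᶜ proj (suc zero)) (proj (suc zero) ∸ᶜ proj zero) oneᶜ

  lessCode : Code o 2
  lessCode = succᶜ (proj zero) ∸ᶜ proj (suc zero)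

  greaterCode : Code o 2
  greaterCode = succᶜ (proj (suc zero)) ∸ᶜ proj zero

module _ {A : Oracle} {o : Bool} where

  eval-apartCode : ∀ z y → Eval A (apartCode {o}) (z ∷ y ∷ []) (apart z y)
  eval-apartCode z y = eval-ifZeroᶜ (eval-∸ᶜ ev-proj ev-proj) (eval-∸ᶜ ev-proj ev-proj) eval-oneᶜ

  eval-lessCode : ∀ z y → Eval A (lessCode {o}) (z ∷ y ∷ []) (suc z ∸ y)
  eval-lessCode z y = eval-∸ᶜ (eval-succᶜ ev-proj) ev-proj

  eval-greaterCode : ∀ z y → Eval A (greaterCode {o}) (z ∷ y ∷ []) (suc y ∸ z)
  eval-greaterCode z y = eval-∸ᶜ (eval-succᶜ ev-proj) ev-proj

module _ {o N} (c : Code o (N + 1)) where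

  private
    module Value   = Search c apartCode eval-apartCode
    module Smaller = Search c lessCode eval-lessCode
    module Larger  = Search c greaterCode eval-greaterCode

  valueCode smallerValueCode largerValueCode : Code o (N + 1)
  valueCode        = Value.searchCode
  smallerValueCode = Smaller.searchCode
  largerValueCode  = Larger.searchCode

  module _ (A : Oracle) (xs : Vec ℕ N) (y : ℕ) where

    attained⇔valueCode-halts : (∃ λ t → Eval A c (xs ++ t ∷ []) y) ⇔ Halts A valueCode (xs ++ y ∷ [])
    attained⇔valueCode-halts = ⇔-trans
      (mk⇔ (λ (t , e) → t , y , e , apart-refl y)
           (λ (t , z , e , apart≡0) → t , subst (Eval A c _) (apart≡0⇒≡ z y apart≡0) e))
      (⇔-sym (Value.searchCode-halts⇔ A xs y))

    lowerBound⇔¬smallerValueCode-halts :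
      (∀ t z → Eval A c (xs ++ t ∷ []) z → y ≤ z) ⇔ (¬ Halts A smallerValueCode (xs ++ y ∷ []))
    lowerBound⇔¬smallerValueCode-halts = mk⇔
      (λ bound halts → let (t , z , e , 1+z∸y≡0) = to (Smaller.searchCode-halts⇔ A xs y) halts
                       in <⇒≱ (m∸n≡0⇒m≤n 1+z∸y≡0) (bound t z e))
      (λ ¬halts t z e → ≮⇒≥ λ z<y →
        ¬halts (from (Smaller.searchCode-halts⇔ A xs y) (t , z , e , m≤n⇒m∸n≡0 z<y)))

    upperBound⇔¬largerValueCode-halts :
      (∀ t z → Eval A c (xs ++ t ∷ []) z → z ≤ y) ⇔ (¬ Halts A largerValueCode (xs ++ y ∷ []))
    upperBound⇔¬largerValueCode-halts = mk⇔
      (λ bound halts → let (t , z , e , 1+y∸z≡0) = to (Larger.searchCode-halts⇔ A xs y) halts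
                       in <⇒≱ (m∸n≡0⇒m≤n 1+y∸z≡0) (bound t z e))
      (λ ¬halts t z e → ≮⇒≥ λ y<z →
        ¬halts (from (Larger.searchCode-halts⇔ A xs y) (t , z , e , m≤n⇒m∸n≡0 y<z)))

module _ {k o} (A : Oracle) (X : BasicSet) (c : Code o (length X + 1)) (x : El k X) (y : ℕ) where

  private
    input : Vec ℕ (length X + 1)
    input = encode X x ++ y ∷ []

  minGraph⇔ : MinGraph (Φ A X c) x y ⇔ (Halts A (valueCode c) input × ¬ Halts A (smallerValueCode c) input)
  minGraph⇔ = attained⇔valueCode-halts c A _ y ×-⇔ lowerBound⇔¬smallerValueCode-halts c A _ y

  maxGraph⇔ : MaxGraph (Φ A X c) x y ⇔ (Halts A (valueCode c) input × ¬ Halts A (largerValueCode c) input)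
  maxGraph⇔ = attained⇔valueCode-halts c A _ y ×-⇔ upperBound⇔¬largerValueCode-halts c A _ y

module _ {k : ℕ} {X : BasicSet} where

  private
    Halts[_,_] : ∀ {o} → Oracle → Code o (length X + 1) → El k X → ℕ → Set
    Halts[ A , c ] x y = Halts A c (encode X x ++ y ∷ [])

  sigmaPiGraph : ∀ {o A} {f : El k X → ℕ → Set} (cS cP : Code o (length X + 1)) →
                 (∀ x y → f x y ⇔ (Halts[ A , cS ] x y × ¬ Halts[ A , cP ] x y)) → SigmaPiGraph k o A X f
  sigmaPiGraph cS cP f⇔ = _ , _ , (cS , λ _ _ → ⇔-refl) , (cP , λ _ _ → ⇔-refl) , f⇔

  sigmaPiGraphF : ∀ {F : El k X → Oracle → ℕ → Set} (cS cP : Code true (length X + 1)) →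
                  (∀ x A y → F x A y ⇔ (Halts[ A , cS ] x y × ¬ Halts[ A , cP ] x y)) → SigmaPiGraphF k X F
  sigmaPiGraphF cS cP F⇔ = _ , _ , (cS , λ _ _ _ → ⇔-refl) , (cP , λ _ _ _ → ⇔-refl) , F⇔

  minMax-sigmaPiGraph : ∀ {o} A (f : El k X → ℕ → Set) →
                        InMin k o A X f ⊎ InMax k o A X f → SigmaPiGraph k o A X f
  minMax-sigmaPiGraph A f (inj₁ (c , f⇔)) =
    sigmaPiGraph (valueCode c) (smallerValueCode c) λ x y → ⇔-trans (f⇔ x y) (minGraph⇔ A X c x y)
  minMax-sigmaPiGraph A f (inj₂ (c , f⇔)) =
    sigmaPiGraph (valueCode c) (largerValueCode c) λ x y → ⇔-trans (f⇔ x y) (maxGraph⇔ A X c x y)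

  minMax-sigmaPiGraphF : (F : El k X → Oracle → ℕ → Set) →
                         InMinPC k X F ⊎ InMaxPC k X F → SigmaPiGraphF k X F
  minMax-sigmaPiGraphF F (inj₁ (c , F⇔)) =
    sigmaPiGraphF (valueCode c) (smallerValueCode c) λ x A y → ⇔-trans (F⇔ x A y) (minGraph⇔ A X c x y)
  minMax-sigmaPiGraphF F (inj₂ (c , F⇔)) =
    sigmaPiGraphF (valueCode c) (largerValueCode c) λ x A y → ⇔-trans (F⇔ x A y) (maxGraph⇔ A X c x y)

propositionp : (k : ℕ) (X : BasicSet) →
    ((f : El k X → ℕ → Set) →
        InMin k false noOracle X f ⊎ InMax k false noOracle X f →
        SigmaPiGraph k false noOracle X f)
    × ((F : El k X → Oracle → ℕ → Set) →
        InMinPC k X F ⊎ InMaxPC k X F → SigmaPiGraphF k X F)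
    × ((A : Oracle) (f : El k X → ℕ → Set) →
        InMin k true A X f ⊎ InMax k true A X f →
        SigmaPiGraph k true A X f)
propositionp k X = minMax-sigmaPiGraph noOracle , minMax-sigmaPiGraphF , minMax-sigmaPiGraph
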